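{- Let $A=\{1,-1\}$ and for $m\ge 3$ identify $A^{\frac{m^2-m}{2}}$ with the set of $m\times m$ symmetric matrices having $1$ on the diagonal and entries in $\{1,-1\}$ off the diagonal. Let $P_m\subseteq A^{\frac{m^2-m}{2}}$ be the set of matrices $M$ that are tensor powers, i.e., for which there is $\alpha\in\{1,-1\}^m$ with $M_{i,j}=\alpha_i\alpha_j$ for all $i,j$. Then $P_m$ is testable inside $A^{\frac{m^2-m}{2}}$ via the algorithm: choose a set of three distinct indices $\{i,j,k\}\subseteq[m]$ uniformly at random and answer "yes" if $M_{i,j}M_{j,k}M_{k,i}=1$ and "no" otherwise. That is, there is $\epsilon>0$ independent of $m$ such that this algorithm is a $(3,\epsilon)$-tester for $P_m$ for every $m$.
   Context: A randomized algorithm is a $(q,\epsilon)$-tester for $P\subseteq W\subseteq A^n$ ($q\in\mathbb{N}$, $\epsilon>0$) if, on input $\alpha\in W$, it queries only $q$ coordinates of $\alpha$, always answers "yes" if $\alpha\in P$, and answers "no" with probability at least $\epsilon\cdot\overline{dist}(\alpha,P)$, where $\overline{dist}(\alpha,P)$ is the normalized Hamming distance (here over the $\frac{m^2-m}{2}$ off-diagonal entries above the diagonal). -}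

module Defs where

open import Data.Nat using (ℕ; zero; suc; _⊓_)
open import Data.Bool using (Bool; true; false; not; _∧_; if_then_else_)
open import Data.Fin using (Fin; zero; suc; _<_; _<?_)
open import Data.List using (List; []; _∷_; concatMap; filter; length; map; foldr; allFin; _++_)
open import Data.Product using (_×_; _,_)
open import Relation.Nullary.Decidable using (does)
open import Relation.Binary.PropositionalEquality using (_≡_)
open import Data.Product using (Σ)

-- Sign encoding: true = +1, false = -1.  Product of signs is xnor.
_·_ : Bool → Bool → Bool
true  · b = b
false · b = not b

Matrix : ℕ → Set
Matrix m = Fin m → Fin m → Bool

-- The index set of A^{(m²-m)/2}: pairs i<j.
pairs : (m : ℕ) → List (Fin m × Fin m)
pairs m = concatMap (λ i → map (λ j → (i , j)) (filter (λ j → i <? j) (allFin m))) (allFin m)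

triples : (m : ℕ) → List (Fin m × Fin m × Fin m)
triples m = concatMap (λ p → pick p) (pairs m)
  where
  pick : Fin m × Fin m → List (Fin m × Fin m × Fin m)
  pick (i , j) = map (λ k → (i , j , k)) (filter (λ k → j <? k) (allFin m))

count : {X : Set} → (X → Bool) → List X → ℕ
count p [] = 0
count p (x ∷ xs) = if p x then suc (count p xs) else count p xs

rejecting : {m : ℕ} → Matrix m → ℕ
rejecting {m} M = count (λ { (i , j , k) → not ((M i j · M j k) · M k i) }) (triples m)

allSigns : (m : ℕ) → List (Fin m → Bool)
allSigns zero = (λ ()) ∷ []
allSigns (suc m) = concatMap (λ α → (λ { zero → true ; (suc i) → α i })
                                  ∷ (λ { zero → false ; (suc i) → α i }) ∷ []) (allSigns m)

tensor : {m : ℕ} → (Fin m → Bool) → Matrix m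
tensor α i j = α i · α j

hamming : {m : ℕ} → Matrix m → Matrix m → ℕ
hamming {m} M N = count (λ { (i , j) → not (M i j · N i j) }) (pairs m)

-- (Unnormalised) distance from M to P_m = minimum over α of hamming M (α⊗α).
-- The fold starts at |pairs m|, an upper bound of every hamming distance.
distP : {m : ℕ} → Matrix m → ℕ
distP {m} M = foldr (λ α d → hamming M (tensor α) ⊓ d) (length (pairs m)) (allSigns m)

InP : {m : ℕ} → Matrix m → Set
InP {m} M = Σ (Fin m → Bool) (λ α → ∀ i j → M i j ≡ tensor α i j)

-- The matrices identified with A^{(m²-m)/2}: symmetric with 1 on the diagonal.
Admissible : {m : ℕ} → Matrix m → Set
Admissible M = (∀ i j → M i j ≡ M j i) × (∀ i → M i i ≡ true)

module Submission where

-- Proof idea (ε = 1/3).  Call the triangle {i,j,k} of M rejected when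
-- M_ij M_jk M_ki = -1.  A tensor power α⊗α has no rejected triangle, which is
-- perfect completeness.  For soundness fix a vertex v and compare M with the
-- tensor power of its own row, M v ⊗ M v: the entry (i,j) differs exactly when
-- the triangle {v,i,j} is rejected, so  dist(M, P) ≤ #{i<j : {v,i,j} rejected}
-- for every v.  Summing over v counts every rejected triangle three times (once
-- per vertex), so  m · dist(M, P) ≤ 3 · rejecting M,  and  C(m,3) ≤ m · C(m,2)
-- turns this into the claimed inequality.

open import Defs
open import Data.Nat using (ℕ; _*_; _≤_; _<_)
open import Data.Nat.Combinatorics using (_C_)
open import Data.Product using (Σ; _×_)
open import Relation.Binary.PropositionalEquality using (_≡_)

open import Data.Bool using (Bool; true; false; not)
open import Data.Bool.Properties using (not-involutive)
open import Data.Empty using (⊥-elim)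
open import Data.Fin using (Fin; zero; suc; _<?_; _≟_)
import Data.Fin as Fin
import Data.Fin.Properties as Fin
open import Data.List using (List; []; _∷_; _++_; concatMap; filter; map; foldr; tabulate; allFin)
open import Data.List.Properties using (map-++; map-∘; map-cong)
open import Data.List.Relation.Unary.Any using (Any; here; there)
import Data.List.Relation.Unary.Any as Any
open import Data.List.Relation.Unary.Any.Properties using (concatMap⁺)
open import Data.Nat using (zero; suc; _+_; _⊓_; z≤n; s≤s; NonZero)
open import Data.Nat.Combinatorics using (nCk+nC[k+1]≡[n+1]C[k+1])
open import Data.Nat.ListAction using () renaming (sum to listSum)
open import Data.Nat.ListAction.Properties using () renaming (sum-++ to listSum-++)
open import Data.Nat.Properties
  using (+-*-semiring; *-commutativeSemigroup; +-identityʳ; *-identityˡ; *-zeroʳ; *-assoc;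
         ≤-refl; ≤-trans; ≤-reflexive; m≤n+m; m⊓n≤m; m⊓n≤n; +-mono-≤; +-monoʳ-≤;
         *-monoˡ-≤; *-monoʳ-≤; *-cancelˡ-≤; module ≤-Reasoning)
open import Algebra.Properties.Semiring.Sum +-*-semiring
  using (sum-syntax; sum-cong-≗; ∑-comm; ∑-distrib-+; *-distribˡ-sum)
open import Algebra.Properties.CommutativeSemigroup *-commutativeSemigroup using (x∙yz≈y∙xz)
open import Data.Nat.Tactic.RingSolver using (solve-∀)
open import Data.Product using (_,_)
open import Data.Sum using (_⊎_; inj₁; inj₂)
open import Function using (_∘_)
open import Relation.Nullary using (Dec; does; yes; no; ¬_)
open import Relation.Nullary.Decidable using (dec-true; dec-false)
open import Relation.Binary using (tri<; tri≈; tri>)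
open import Relation.Binary.PropositionalEquality
  using (_≢_; refl; sym; trans; cong; cong₂; subst; _≗_; module ≡-Reasoning)

𝟙 : Bool → ℕ
𝟙 true  = 1
𝟙 false = 0

𝟙[_<_] : {m : ℕ} → Fin m → Fin m → ℕ
𝟙[ i < j ] = 𝟙 (does (i <? j))

𝟙[<]≡1 : {m : ℕ} {i j : Fin m} → i Fin.< j → 𝟙[ i < j ] ≡ 1
𝟙[<]≡1 {i = i} {j} i<j = cong 𝟙 (dec-true (i <? j) i<j)

𝟙[<]≡0 : {m : ℕ} {i j : Fin m} → ¬ i Fin.< j → 𝟙[ i < j ] ≡ 0
𝟙[<]≡0 {i = i} {j} i≮j = cong 𝟙 (dec-false (i <? j) i≮j)

count-as-sum : {X : Set} (p : X → Bool) (xs : List X) →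
               count p xs ≡ listSum (map (𝟙 ∘ p) xs)
count-as-sum p []       = refl
count-as-sum p (x ∷ xs) with p x
... | true  = cong suc (count-as-sum p xs)
... | false = count-as-sum p xs

count-cong : {X : Set} {p q : X → Bool} → p ≗ q → (xs : List X) → count p xs ≡ count q xs
count-cong {p = p} {q} p≗q xs = begin
  count p xs                  ≡⟨ count-as-sum p xs ⟩
  listSum (map (𝟙 ∘ p) xs)    ≡⟨ cong listSum (map-cong (cong 𝟙 ∘ p≗q) xs) ⟩
  listSum (map (𝟙 ∘ q) xs)    ≡⟨ count-as-sum q xs ⟨
  count q xs                  ∎
  where open ≡-Reasoning

count-none : {X : Set} (p : X → Bool) → (∀ x → p x ≡ false) → (xs : List X) → count p xs ≡ 0
count-none p none []       = refl
count-none p none (x ∷ xs) rewrite none x = count-none p none xs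

listSum-concatMap : {X Y : Set} (f : Y → ℕ) (g : X → List Y) (xs : List X) →
  listSum (map f (concatMap g xs)) ≡ listSum (map (λ x → listSum (map f (g x))) xs)
listSum-concatMap f g []       = refl
listSum-concatMap f g (x ∷ xs) = begin
  listSum (map f (g x ++ concatMap g xs))
    ≡⟨ cong listSum (map-++ f (g x) (concatMap g xs)) ⟩
  listSum (map f (g x) ++ map f (concatMap g xs))
    ≡⟨ listSum-++ (map f (g x)) (map f (concatMap g xs)) ⟩
  listSum (map f (g x)) + listSum (map f (concatMap g xs))
    ≡⟨ cong (listSum (map f (g x)) +_) (listSum-concatMap f g xs) ⟩
  listSum (map f (g x)) + listSum (map (λ y → listSum (map f (g y))) xs) ∎
  where open ≡-Reasoning

listSum-filter : {X : Set} {P : X → Set} (f : X → ℕ) (P? : ∀ x → Dec (P x)) (xs : List X) →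
  listSum (map f (filter P? xs)) ≡ listSum (map (λ x → 𝟙 (does (P? x)) * f x) xs)
listSum-filter f P? []       = refl
listSum-filter f P? (x ∷ xs) with does (P? x)
... | true  = cong₂ _+_ (sym (+-identityʳ (f x))) (listSum-filter f P? xs)
... | false = listSum-filter f P? xs

listSum-tabulate : {X : Set} {m : ℕ} (f : X → ℕ) (g : Fin m → X) →
  listSum (map f (tabulate g)) ≡ ∑[ i < m ] (f (g i))
listSum-tabulate {m = zero}  f g = refl
listSum-tabulate {m = suc m} f g = cong (f (g zero) +_) (listSum-tabulate f (g ∘ suc))

listSum-row : {X : Set} {m : ℕ} {P : Fin m → Set} (f : X → ℕ) (h : Fin m → X)
  (P? : ∀ j → Dec (P j)) →
  listSum (map f (map h (filter P? (allFin m)))) ≡ ∑[ j < m ] (𝟙 (does (P? j)) * f (h j))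
listSum-row {m = m} f h P? = begin
  listSum (map f (map h (filter P? (allFin m))))  ≡⟨ cong listSum (map-∘ (filter P? (allFin m))) ⟨
  listSum (map (f ∘ h) (filter P? (allFin m)))    ≡⟨ listSum-filter (f ∘ h) P? (allFin m) ⟩
  listSum (map (λ j → 𝟙 (does (P? j)) * f (h j)) (allFin m))
    ≡⟨ listSum-tabulate (λ j → 𝟙 (does (P? j)) * f (h j)) (λ j → j) ⟩
  ∑[ j < m ] (𝟙 (does (P? j)) * f (h j))          ∎
  where open ≡-Reasoning

listSum-pairs : {m : ℕ} (g : Fin m × Fin m → ℕ) →
  listSum (map g (pairs m)) ≡ ∑[ i < m ] ∑[ j < m ] (𝟙[ i < j ] * g (i , j))
listSum-pairs {m} g = begin
  listSum (map g (concatMap row (allFin m)))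
    ≡⟨ listSum-concatMap g row (allFin m) ⟩
  listSum (map (λ i → listSum (map g (row i))) (allFin m))
    ≡⟨ listSum-tabulate (λ i → listSum (map g (row i))) (λ i → i) ⟩
  ∑[ i < m ] listSum (map g (row i))
    ≡⟨ sum-cong-≗ (λ i → listSum-row g (i ,_) (i <?_)) ⟩
  ∑[ i < m ] ∑[ j < m ] (𝟙[ i < j ] * g (i , j)) ∎
  where
  open ≡-Reasoning
  row : Fin m → List (Fin m × Fin m)
  row i = map (i ,_) (filter (i <?_) (allFin m))

listSum-triples : {m : ℕ} (g : Fin m × Fin m × Fin m → ℕ) →
  listSum (map g (triples m)) ≡
  ∑[ i < m ] ∑[ j < m ] (𝟙[ i < j ] * ∑[ k < m ] (𝟙[ j < k ] * g (i , j , k)))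
listSum-triples {m} g = begin
  listSum (map g (concatMap extend (pairs m)))
    ≡⟨ listSum-concatMap g extend (pairs m) ⟩
  listSum (map (λ p → listSum (map g (extend p))) (pairs m))
    ≡⟨ listSum-pairs (λ p → listSum (map g (extend p))) ⟩
  ∑[ i < m ] ∑[ j < m ] (𝟙[ i < j ] * listSum (map g (extend (i , j))))
    ≡⟨ sum-cong-≗ (λ i → sum-cong-≗ (λ j →
         cong (𝟙[ i < j ] *_) (listSum-row g (λ k → (i , j , k)) (j <?_)))) ⟩
  ∑[ i < m ] ∑[ j < m ] (𝟙[ i < j ] * ∑[ k < m ] (𝟙[ j < k ] * g (i , j , k))) ∎
  where
  open ≡-Reasoning
  extend : Fin m × Fin m → List (Fin m × Fin m × Fin m)
  extend (i , j) = map (λ k → (i , j , k)) (filter (j <?_) (allFin m))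

∑³ : {m : ℕ} → (Fin m → Fin m → Fin m → ℕ) → ℕ
∑³ {m} g = ∑[ a < m ] ∑[ b < m ] ∑[ c < m ] g a b c

∑³-cong : {m : ℕ} {g h : Fin m → Fin m → Fin m → ℕ} →
          (∀ a b c → g a b c ≡ h a b c) → ∑³ g ≡ ∑³ h
∑³-cong g≡h = sum-cong-≗ (λ a → sum-cong-≗ (λ b → sum-cong-≗ (λ c → g≡h a b c)))

∑³-distrib-+ : {m : ℕ} (g h : Fin m → Fin m → Fin m → ℕ) →
               ∑³ (λ a b c → g a b c + h a b c) ≡ ∑³ g + ∑³ h
∑³-distrib-+ {m} g h = begin
  ∑³ (λ a b c → g a b c + h a b c)
    ≡⟨ sum-cong-≗ (λ a → trans (sum-cong-≗ (λ b → ∑-distrib-+ (g a b) (h a b)))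
                                (∑-distrib-+ (λ b → ∑[ c < m ] g a b c) (λ b → ∑[ c < m ] h a b c))) ⟩
  ∑[ a < m ] (∑[ b < m ] ∑[ c < m ] g a b c + ∑[ b < m ] ∑[ c < m ] h a b c)
    ≡⟨ ∑-distrib-+ (λ a → ∑[ b < m ] ∑[ c < m ] g a b c) (λ a → ∑[ b < m ] ∑[ c < m ] h a b c) ⟩
  ∑³ g + ∑³ h ∎
  where open ≡-Reasoning

increasing : {m : ℕ} → (Fin m → Fin m → Fin m → ℕ) → Fin m → Fin m → Fin m → ℕ
increasing g a b c = 𝟙[ a < b ] * (𝟙[ b < c ] * g a b c)

-- A third point v ∉ {i, j} lies before, between or after i < j in
-- exactly one way; if i ≮ j none of the three configurations occurs.
placements : {m : ℕ} → Fin m → Fin m → Fin m → ℕ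
placements v i j = 𝟙[ v < i ] * 𝟙[ i < j ] + 𝟙[ i < v ] * 𝟙[ v < j ] + 𝟙[ i < j ] * 𝟙[ j < v ]

-- The two configurations of betweenness in which the order of i and j is not
-- determined by their position relative to v (v before both, v after both).
only-first : ∀ x y → x ≡ 1 * x + 0 * y + x * 0
only-first = solve-∀

only-last : ∀ x → x ≡ 0 * x + 1 * 0 + x * 1
only-last = solve-∀

betweenness : {m : ℕ} {v i j : Fin m} → v ≢ i → v ≢ j → 𝟙[ i < j ] ≡ placements v i j
betweenness {v = v} {i} {j} v≢i v≢j with Fin.<-cmp v i | Fin.<-cmp v j
... | tri≈ _ v≡i _ | _            = ⊥-elim (v≢i v≡i)
... | _            | tri≈ _ v≡j _ = ⊥-elim (v≢j v≡j)
... | tri< v<i _ _ | tri< v<j _ _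
  rewrite 𝟙[<]≡1 v<i | 𝟙[<]≡0 (Fin.<-asym v<i) | 𝟙[<]≡0 (Fin.<-asym v<j)
  = only-first 𝟙[ i < j ] 𝟙[ v < j ]
... | tri< v<i _ _ | tri> _ _ j<v
  rewrite 𝟙[<]≡0 (Fin.<-asym (Fin.<-trans j<v v<i)) | 𝟙[<]≡1 v<i | 𝟙[<]≡0 (Fin.<-asym v<i)
  = refl
... | tri> _ _ i<v | tri< v<j _ _
  rewrite 𝟙[<]≡1 (Fin.<-trans i<v v<j) | 𝟙[<]≡0 (Fin.<-asym i<v) | 𝟙[<]≡1 i<v | 𝟙[<]≡1 v<j | 𝟙[<]≡0 (Fin.<-asym v<j)
  = refl
... | tri> _ _ i<v | tri> _ _ j<v
  rewrite 𝟙[<]≡0 (Fin.<-asym i<v) | 𝟙[<]≡1 i<v | 𝟙[<]≡0 (Fin.<-asym j<v) | 𝟙[<]≡1 j<v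
  = only-last 𝟙[ i < j ]

*-zero-weight : ∀ a b {x} → x ≡ 0 → a * x ≡ b * x
*-zero-weight a b refl = trans (*-zeroʳ a) (sym (*-zeroʳ b))

weighted-betweenness : {m : ℕ} (v i j : Fin m) (x : ℕ) → (v ≡ i ⊎ v ≡ j → x ≡ 0) →
  𝟙[ i < j ] * x ≡ placements v i j * x
weighted-betweenness v i j x vanish with v ≟ i | v ≟ j
... | yes v≡i | _       = *-zero-weight 𝟙[ i < j ] (placements v i j) (vanish (inj₁ v≡i))
... | no _    | yes v≡j = *-zero-weight 𝟙[ i < j ] (placements v i j) (vanish (inj₂ v≡j))
... | no v≢i  | no v≢j  = cong (_* x) (betweenness v≢i v≢j)

distribute-weight : ∀ a b c d e x →
  (a * b + c * d + b * e) * x ≡ a * (b * x) + c * (d * x) + b * (e * x)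
distribute-weight = solve-∀

module DoubleCounting {m : ℕ} (f : Fin m → Fin m → Fin m → ℕ)
  (swap       : ∀ v i j → f v i j ≡ f i v j)
  (rotate     : ∀ v i j → f v i j ≡ f i j v)
  (degenerate : ∀ i j → f i i j ≡ 0) where

  -- By symmetry f also vanishes when v coincides with the last index.
  vanish : ∀ v i j → v ≡ i ⊎ v ≡ j → f v i j ≡ 0
  vanish v .v j (inj₁ refl) = degenerate v j
  vanish v i .v (inj₂ refl) = trans (swap v i v) (trans (rotate i v v) (degenerate v i))

  -- Inserting v into the pair i < j: v lands before, between or after them.
  insertion : ∀ v i j →
    𝟙[ i < j ] * f v i j ≡ increasing f v i j + increasing f i v j + increasing f i j v
  insertion v i j = begin
    𝟙[ i < j ] * f v i j
      ≡⟨ weighted-betweenness v i j (f v i j) (vanish v i j) ⟩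
    placements v i j * f v i j
      ≡⟨ distribute-weight 𝟙[ v < i ] 𝟙[ i < j ] 𝟙[ i < v ] 𝟙[ v < j ] 𝟙[ j < v ] (f v i j) ⟩
    increasing f v i j + 𝟙[ i < v ] * (𝟙[ v < j ] * f v i j) + 𝟙[ i < j ] * (𝟙[ j < v ] * f v i j)
      ≡⟨ cong₂ (λ y z → increasing f v i j + 𝟙[ i < v ] * (𝟙[ v < j ] * y) + 𝟙[ i < j ] * (𝟙[ j < v ] * z))
               (swap v i j) (rotate v i j) ⟩
    increasing f v i j + increasing f i v j + increasing f i j v ∎
    where open ≡-Reasoning

  -- Each increasing triple is counted once for each of its three points.
  triangles-through-vertices :
    ∑[ v < m ] ∑[ i < m ] ∑[ j < m ] (𝟙[ i < j ] * f v i j) ≡ 3 * ∑³ (increasing f)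
  triangles-through-vertices = begin
    ∑³ (λ v i j → 𝟙[ i < j ] * f v i j)
      ≡⟨ ∑³-cong insertion ⟩
    ∑³ (λ v i j → T v i j + T i v j + T i j v)
      ≡⟨ ∑³-distrib-+ (λ v i j → T v i j + T i v j) (λ v i j → T i j v) ⟩
    ∑³ (λ v i j → T v i j + T i v j) + ∑³ (λ v i j → T i j v)
      ≡⟨ cong (_+ ∑³ (λ v i j → T i j v)) (∑³-distrib-+ T (λ v i j → T i v j)) ⟩
    ∑³ T + ∑³ (λ v i j → T i v j) + ∑³ (λ v i j → T i j v)
      ≡⟨ cong₂ (λ y z → ∑³ T + y + z) middle-first last-first ⟩
    ∑³ T + ∑³ T + ∑³ T
      ≡⟨ thrice (∑³ T) ⟩
    3 * ∑³ T ∎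
    where
    open ≡-Reasoning
    T = increasing f
    middle-first : ∑³ (λ v i j → T i v j) ≡ ∑³ T
    middle-first = ∑-comm (λ v i → ∑[ j < m ] T i v j)
    last-first : ∑³ (λ v i j → T i j v) ≡ ∑³ T
    last-first = trans (∑-comm (λ v i → ∑[ j < m ] T i j v))
                       (sum-cong-≗ (λ i → ∑-comm (λ v j → T i j v)))
    thrice : ∀ r → r + r + r ≡ 3 * r
    thrice = solve-∀

∑-lower-bound : {m : ℕ} (c : ℕ) (g : Fin m → ℕ) → (∀ i → c ≤ g i) → m * c ≤ ∑[ i < m ] g i
∑-lower-bound {zero}  c g c≤g = z≤n
∑-lower-bound {suc m} c g c≤g = +-mono-≤ (c≤g zero) (∑-lower-bound c (g ∘ suc) (c≤g ∘ suc))

not-·ˡ : ∀ x y → not x · y ≡ not (x · y)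
not-·ˡ true  y = refl
not-·ˡ false y = sym (not-involutive y)

·-comm : ∀ x y → x · y ≡ y · x
·-comm true  true  = refl
·-comm true  false = refl
·-comm false true  = refl
·-comm false false = refl

·-assoc : ∀ x y z → (x · y) · z ≡ x · (y · z)
·-assoc true  y z = refl
·-assoc false y z = not-·ˡ y z

·-self : ∀ x → x · x ≡ true
·-self true  = refl
·-self false = refl

·-exchange : ∀ x y z → (x · y) · z ≡ (x · z) · y
·-exchange x y z = begin
  (x · y) · z  ≡⟨ ·-assoc x y z ⟩
  x · (y · z)  ≡⟨ cong (x ·_) (·-comm y z) ⟩
  x · (z · y)  ≡⟨ ·-assoc x z y ⟨
  (x · z) · y  ∎
  where open ≡-Reasoning

tensor-triangle : ∀ a b c → ((a · b) · (b · c)) · (c · a) ≡ true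
tensor-triangle true  true  true  = refl
tensor-triangle true  true  false = refl
tensor-triangle true  false true  = refl
tensor-triangle true  false false = refl
tensor-triangle false true  true  = refl
tensor-triangle false true  false = refl
tensor-triangle false false true  = refl
tensor-triangle false false false = refl

rejects : {m : ℕ} → Matrix m → Fin m → Fin m → Fin m → Bool
rejects M i j k = not ((M i j · M j k) · M k i)

rejects-rotate : {m : ℕ} (M : Matrix m) → ∀ v i j → rejects M v i j ≡ rejects M i j v
rejects-rotate M v i j = cong not (trans (·-assoc (M v i) (M i j) (M j v))
                                         (·-comm (M v i) (M i j · M j v)))

tensor-never-rejected : {m : ℕ} (M : Matrix m) → InP M → rejecting M ≡ 0
tensor-never-rejected {m} M (α , M≡α⊗α) =
  count-none _ (λ { (i , j , k) → cong not (begin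
      (M i j · M j k) · M k i
        ≡⟨ cong₂ _·_ (cong₂ _·_ (M≡α⊗α i j) (M≡α⊗α j k)) (M≡α⊗α k i) ⟩
      ((α i · α j) · (α j · α k)) · (α k · α i)
        ≡⟨ tensor-triangle (α i) (α j) (α k) ⟩
      true ∎) })
    (triples m)
  where open ≡-Reasoning

module _ {m : ℕ} (M : Matrix m) (symmetric : ∀ i j → M i j ≡ M j i) where

  rejects-swap : ∀ v i j → rejects M v i j ≡ rejects M i v j
  rejects-swap v i j = cong not (begin
    (M v i · M i j) · M j v  ≡⟨ ·-exchange (M v i) (M i j) (M j v) ⟩
    (M v i · M j v) · M i j  ≡⟨ cong₂ _·_ (cong₂ _·_ (symmetric v i) (symmetric j v)) (symmetric i j) ⟩
    (M i v · M v j) · M j i  ∎)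
    where open ≡-Reasoning

  rejects-degenerate : (∀ i → M i i ≡ true) → ∀ i j → rejects M i i j ≡ false
  rejects-degenerate diagonal i j
    rewrite diagonal i | symmetric j i | ·-self (M i j) = refl

  -- M differs from the tensor power of its row v exactly at the pairs i < j
  -- for which the triangle {v, i, j} is rejected.
  hamming-to-row : ∀ v → hamming M (tensor (M v)) ≡
                         ∑[ i < m ] ∑[ j < m ] (𝟙[ i < j ] * 𝟙 (rejects M v i j))
  hamming-to-row v = begin
    hamming M (tensor (M v))
      ≡⟨ count-as-sum _ (pairs m) ⟩
    listSum (map (λ { (i , j) → 𝟙 (not (M i j · (M v i · M v j))) }) (pairs m))
      ≡⟨ listSum-pairs (λ { (i , j) → 𝟙 (not (M i j · (M v i · M v j))) }) ⟩
    ∑[ i < m ] ∑[ j < m ] (𝟙[ i < j ] * 𝟙 (not (M i j · (M v i · M v j))))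
      ≡⟨ sum-cong-≗ (λ i → sum-cong-≗ (λ j →
           cong (λ s → 𝟙[ i < j ] * 𝟙 (not s)) (row-sign i j))) ⟩
    ∑[ i < m ] ∑[ j < m ] (𝟙[ i < j ] * 𝟙 (rejects M v i j)) ∎
    where
    open ≡-Reasoning
    row-sign : ∀ i j → M i j · (M v i · M v j) ≡ (M v i · M i j) · M j v
    row-sign i j = begin
      M i j · (M v i · M v j)  ≡⟨ ·-assoc (M i j) (M v i) (M v j) ⟨
      (M i j · M v i) · M v j  ≡⟨ cong₂ _·_ (·-comm (M i j) (M v i)) (symmetric v j) ⟩
      (M v i · M i j) · M j v  ∎

rejecting-as-sum : {m : ℕ} (M : Matrix m) →
                   rejecting M ≡ ∑³ (increasing (λ i j k → 𝟙 (rejects M i j k)))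
rejecting-as-sum {m} M = begin
  rejecting M
    ≡⟨ count-as-sum _ (triples m) ⟩
  listSum (map (λ { (i , j , k) → 𝟙 (rejects M i j k) }) (triples m))
    ≡⟨ listSum-triples (λ { (i , j , k) → 𝟙 (rejects M i j k) }) ⟩
  ∑[ i < m ] ∑[ j < m ] (𝟙[ i < j ] * ∑[ k < m ] (𝟙[ j < k ] * 𝟙 (rejects M i j k)))
    ≡⟨ sum-cong-≗ (λ i → sum-cong-≗ (λ j →
         *-distribˡ-sum 𝟙[ i < j ] (λ k → 𝟙[ j < k ] * 𝟙 (rejects M i j k)))) ⟩
  ∑³ (increasing (λ i j k → 𝟙 (rejects M i j k))) ∎
  where open ≡-Reasoning

one-extension-matches : {m : ℕ} {α t f : Fin (suc m) → Bool} →
  t zero ≡ true → f zero ≡ false →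
  (∀ i → t (suc i) ≡ α (suc i)) → (∀ i → f (suc i) ≡ α (suc i)) →
  Any (_≗ α) (t ∷ f ∷ [])
one-extension-matches {α = α} t₀ f₀ tₛ fₛ with α zero in α₀
... | true  = here  λ { zero → trans t₀ (sym α₀) ; (suc i) → tₛ i }
... | false = there (here λ { zero → trans f₀ (sym α₀) ; (suc i) → fₛ i })

allSigns-complete : (m : ℕ) (α : Fin m → Bool) → Any (_≗ α) (allSigns m)
allSigns-complete zero    α = here (λ ())
allSigns-complete (suc m) α = concatMap⁺ _
  (Any.map (λ β≗α → one-extension-matches refl refl β≗α β≗α)
           (allSigns-complete m (α ∘ suc)))

foldr-⊓-≤ : {X : Set} (g : X → ℕ) (c t : ℕ) (xs : List X) →
            Any (λ x → g x ≤ t) xs → foldr (λ x d → g x ⊓ d) c xs ≤ t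
foldr-⊓-≤ g c t (x ∷ xs) (here gx≤t) = ≤-trans (m⊓n≤m (g x) _) gx≤t
foldr-⊓-≤ g c t (x ∷ xs) (there any) = ≤-trans (m⊓n≤n (g x) _) (foldr-⊓-≤ g c t xs any)

hamming-cong : {m : ℕ} (M : Matrix m) {α β : Fin m → Bool} → β ≗ α →
               hamming M (tensor β) ≡ hamming M (tensor α)
hamming-cong {m} M β≗α =
  count-cong (λ { (i , j) → cong (λ s → not (M i j · s)) (cong₂ _·_ (β≗α i) (β≗α j)) }) (pairs m)

distP-≤-hamming : {m : ℕ} (M : Matrix m) (α : Fin m → Bool) → distP M ≤ hamming M (tensor α)
distP-≤-hamming {m} M α =
  foldr-⊓-≤ (λ β → hamming M (tensor β)) _ _ (allSigns m)
    (Any.map (λ β≗α → ≤-reflexive (hamming-cong M β≗α)) (allSigns-complete m α))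

C-mono : ∀ n k → n C k ≤ suc n C k
C-mono n zero    = ≤-refl
C-mono n (suc k) = subst (n C suc k ≤_) (nCk+nC[k+1]≡[n+1]C[k+1] n k) (m≤n+m (n C suc k) (n C k))

C-succ-≤ : ∀ n k → n C suc k ≤ n * (n C k)
C-succ-≤ zero    k = z≤n
C-succ-≤ (suc n) k = begin
  suc n C suc k          ≡⟨ nCk+nC[k+1]≡[n+1]C[k+1] n k ⟨
  n C k + n C suc k      ≤⟨ +-monoʳ-≤ (n C k) (C-succ-≤ n k) ⟩
  suc n * (n C k)        ≤⟨ *-monoʳ-≤ (suc n) (C-mono n k) ⟩
  suc n * (suc n C k)    ∎
  where open ≤-Reasoning

cross-multiply : ∀ m d r c₂ c₃ .{{_ : NonZero m}} → m * d ≤ r → c₃ ≤ m * c₂ → d * c₃ ≤ r * c₂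
cross-multiply m d r c₂ c₃ md≤r c₃≤mc₂ = *-cancelˡ-≤ m (begin
  m * (d * c₃)   ≡⟨ *-assoc m d c₃ ⟨
  m * d * c₃     ≤⟨ *-monoˡ-≤ c₃ md≤r ⟩
  r * c₃         ≤⟨ *-monoʳ-≤ r c₃≤mc₂ ⟩
  r * (m * c₂)   ≡⟨ x∙yz≈y∙xz r m c₂ ⟩
  m * (r * c₂)   ∎)
  where open ≤-Reasoning

soundness : {m : ℕ} (M : Matrix m) → Admissible M → m * distP M ≤ 3 * rejecting M
soundness {m} M (symmetric , diagonal) = begin
  m * distP M
    ≤⟨ ∑-lower-bound (distP M) (λ v → hamming M (tensor (M v))) (λ v → distP-≤-hamming M (M v)) ⟩
  ∑[ v < m ] hamming M (tensor (M v))
    ≡⟨ sum-cong-≗ (hamming-to-row M symmetric) ⟩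
  ∑[ v < m ] ∑[ i < m ] ∑[ j < m ] (𝟙[ i < j ] * 𝟙 (rejects M v i j))
    ≡⟨ DoubleCounting.triangles-through-vertices (λ i j k → 𝟙 (rejects M i j k))
         (λ v i j → cong 𝟙 (rejects-swap M symmetric v i j))
         (λ v i j → cong 𝟙 (rejects-rotate M v i j))
         (λ i j → cong 𝟙 (rejects-degenerate M symmetric diagonal i j)) ⟩
  3 * ∑³ (increasing (λ i j k → 𝟙 (rejects M i j k)))
    ≡⟨ cong (3 *_) (rejecting-as-sum M) ⟨
  3 * rejecting M ∎
  where open ≤-Reasoning

proposition17 : Σ ℕ (λ a → Σ ℕ (λ b → (0 < a) × (0 < b) ×
                  ((m : ℕ) → 3 ≤ m → (M : Matrix m) → Admissible M →
                    (InP M → rejecting M ≡ 0) ×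
                    (a * distP M * (m C 3) ≤ b * rejecting M * (m C 2)))))
-- ε = 1/3, i.e. a = 1 and b = 3; the hypothesis 3 ≤ m is only needed for m > 0.
proposition17 = 1 , 3 , s≤s z≤n , s≤s z≤n , tester
  where
  tester : (m : ℕ) → 3 ≤ m → (M : Matrix m) → Admissible M →
           (InP M → rejecting M ≡ 0) × (1 * distP M * (m C 3) ≤ 3 * rejecting M * (m C 2))
  tester m@(suc _) _ M admissible =
    tensor-never-rejected M ,
    subst (λ d → d * (m C 3) ≤ 3 * rejecting M * (m C 2)) (sym (*-identityˡ (distP M)))
      (cross-multiply m (distP M) (3 * rejecting M) (m C 2) (m C 3)
        (soundness M admissible) (C-succ-≤ m 2))
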